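{- Let $\ell \geq 1$ and $n_1, \dots, n_\ell \in \mathbb{N}$. For the complete $\ell$-partite graph $K_{(n_1, n_2, \dots, n_\ell)}$ we have $\Upsilon(K_{(n_1, \dots, n_\ell)}) = \sum_{i=1}^{\ell} n_i - \ell$.
   Context: $K_{(n_1,\dots,n_\ell)}$ is the complete multipartite graph whose vertex set is partitioned into parts of sizes $n_1,\dots,n_\ell$, with two vertices adjacent iff they lie in different parts. Vertex explosions: start with $G'_0 = G$ (with underlying graph $G^*_0 = G$). Given the mixed graph $G'_i$ (the graph $G$ together with the arcs added so far) with underlying simple graph $G^*_i$, exploding a vertex $w$ produces $G'_{i+1}$ by adding an arc $(w,z)$ for every vertex $z \neq w$ that is not adjacent to $w$ in $G^*_i$. The McPherson number $\Upsilon(G)$ of a graph $G$ on $n$ vertices is the minimum number $\ell$ of successive vertex explosions after which the underlying graph $G^*_\ell$ is isomorphic to the complete graph $K_n$. -}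

module Defs where

open import Data.Nat using (ℕ)
open import Data.Fin using (Fin)
open import Data.Vec using (Vec; lookup)
open import Data.List using (List; []; _∷_; length)
open import Data.Product using (Σ; proj₁; _×_; ∃)
open import Data.Sum using (_⊎_)
open import Relation.Nullary using (¬_)
open import Relation.Binary.PropositionalEquality using (_≡_; _≢_)

record Graph (V : Set) : Set₁ where
  field
    Adj     : V → V → Set
    sym     : ∀ {x y} → Adj x y → Adj y x
    irrefl  : ∀ {x} → ¬ Adj x x

open Graph public

-- A mixed graph G'_i: the graph G together with a set of arcs.
Arcs : Set → Set₁
Arcs V = V → V → Set

UAdj : {V : Set} → Graph V → Arcs V → V → V → Set
UAdj G A x y = Adj G x y ⊎ A x y ⊎ A y x

explode : {V : Set} → Graph V → Arcs V → V → Arcs V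
explode G A w x z = A x z ⊎ (x ≡ w × z ≢ w × ¬ UAdj G A w z)

explodeAll : {V : Set} → Graph V → Arcs V → List V → Arcs V
explodeAll G A []       = A
explodeAll G A (w ∷ ws) = explodeAll G (explode G A w) ws

noArcs : {V : Set} → Arcs V
noArcs x y = Data.Empty.⊥
  where import Data.Empty

-- The underlying graph (on the same vertex set) is complete, i.e. isomorphic to K_n.
CompleteAfter : {V : Set} → Graph V → List V → Set
CompleteAfter G ws = ∀ x y → x ≢ y → UAdj G (explodeAll G noArcs ws) x y

-- Υ(G) = m : some sequence of m explosions makes G* complete, and no shorter one does.
McPherson : {V : Set} → Graph V → ℕ → Set
McPherson G m =
  (Σ (List _) λ ws → length ws ≡ m × CompleteAfter G ws)
  × (∀ ws → CompleteAfter G ws → m Data.Nat.≤ length ws)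

-- Complete multipartite graph K_(n_1,…,n_ℓ): vertices are pairs (part i, index in part i),
-- adjacent iff in different parts.
MPVertex : {ℓ : ℕ} → Vec ℕ ℓ → Set
MPVertex {ℓ} ns = Σ (Fin ℓ) (λ i → Fin (lookup ns i))

completeMultipartite : {ℓ : ℕ} → (ns : Vec ℕ ℓ) → Graph (MPVertex ns)
completeMultipartite ns = record
  { Adj    = λ x y → proj₁ x ≢ proj₁ y
  ; sym    = λ p q → p (Relation.Binary.PropositionalEquality.sym q)
  ; irrefl = λ p → p Relation.Binary.PropositionalEquality.refl
  }

-- Exploding a vertex makes it adjacent to every other vertex, and every arc starts at an
-- exploded vertex.  In K_(n_1,…,n_ℓ) the only non-adjacent pairs lie inside a part, so a
-- sequence of explosions completes the graph iff it leaves at most one vertex of each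
-- part unexploded.  Exploding all vertices except one representative per part therefore
-- suffices, and conversely sending each non-representative vertex either to itself (if it
-- is exploded) or to the representative of its part (which then must be exploded) is an
-- injection into the exploded vertices, so at least Σ nᵢ − ℓ explosions are needed.
module Submission where

open import Defs
open import Data.Nat using (ℕ; _≤_; _∸_; suc; _+_; z≤n; s≤s)
open import Data.Nat.Properties using (≤-trans; ≤-reflexive; m+n∸n≡m; +-assoc; +-suc)
open import Data.Fin using (Fin; zero; suc)
open import Data.Fin.Properties as Fin using (suc-injective)
open import Data.Vec using (Vec; lookup; sum; []; _∷_)
open import Data.List using (List; []; _∷_; length; map; _++_; tabulate)
open import Data.List.Properties using (length-++; length-map; length-tabulate; length-removeAt′)
open import Data.List.Relation.Unary.Any as Any using (here; there; _─_)
open import Data.List.Relation.Unary.All as All using ()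
open import Data.List.Relation.Unary.AllPairs using ([]; _∷_)
open import Data.List.Relation.Unary.Unique.Propositional using (Unique)
import Data.List.Relation.Unary.Unique.Propositional.Properties as Unique
open import Data.List.Membership.Propositional using (_∈_)
open import Data.List.Membership.Propositional.Properties
  using (∈-map⁺; ∈-map⁻; ∈-++⁺ˡ; ∈-++⁺ʳ; ∈-++⁻; ∈-tabulate⁺; ∈-tabulate⁻)
open import Data.List.Membership.DecPropositional using (_∈?_)
open import Data.Product using (_,_; proj₁; _×_)
open import Data.Product.Properties using (≡-dec)
open import Data.Sum using (_⊎_; inj₁; inj₂)
open import Data.Empty using (⊥-elim)
open import Relation.Nullary using (¬_; yes; no)
open import Relation.Nullary.Decidable using (¬?; _×-dec_; _⊎-dec_)
open import Relation.Binary.Definitions using (Decidable; DecidableEquality)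
open import Relation.Binary.PropositionalEquality as ≡ using (_≡_; _≢_; refl; cong)

module Explosion {V : Set} (G : Graph V) where

  UAdj-sym : ∀ {A x y} → UAdj G A x y → UAdj G A y x
  UAdj-sym (inj₁ xy)        = inj₁ (sym G xy)
  UAdj-sym (inj₂ (inj₁ xy)) = inj₂ (inj₂ xy)
  UAdj-sym (inj₂ (inj₂ yx)) = inj₂ (inj₁ yx)

  explode-mono : ∀ {A w x y} → UAdj G A x y → UAdj G (explode G A w) x y
  explode-mono (inj₁ xy)        = inj₁ xy
  explode-mono (inj₂ (inj₁ xy)) = inj₂ (inj₁ (inj₁ xy))
  explode-mono (inj₂ (inj₂ yx)) = inj₂ (inj₂ (inj₁ yx))

  explodeAll-mono : ∀ {A} ws {x y} → UAdj G A x y → UAdj G (explodeAll G A ws) x y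
  explodeAll-mono []       xy = xy
  explodeAll-mono (w ∷ ws) xy = explodeAll-mono ws (explode-mono xy)

  explodeAll-arc : ∀ {A} ws {x z} → explodeAll G A ws x z → A x z ⊎ x ∈ ws
  explodeAll-arc []       xz = inj₁ xz
  explodeAll-arc (w ∷ ws) xz with explodeAll-arc ws xz
  ... | inj₁ (inj₁ xz)         = inj₁ xz
  ... | inj₁ (inj₂ (refl , _)) = inj₂ (here refl)
  ... | inj₂ x∈ws              = inj₂ (there x∈ws)

  explodeAll-noArcs-arc : ∀ ws {x z} → explodeAll G noArcs ws x z → x ∈ ws
  explodeAll-noArcs-arc ws xz with explodeAll-arc ws xz
  ... | inj₂ x∈ws = x∈ws

  complete⇒cover : ∀ ws {x y} → CompleteAfter G ws → x ≢ y → ¬ Adj G x y →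
                   x ∈ ws ⊎ y ∈ ws
  complete⇒cover ws complete x≢y ¬xy with complete _ _ x≢y
  ... | inj₁ xy        = ⊥-elim (¬xy xy)
  ... | inj₂ (inj₁ xy) = inj₁ (explodeAll-noArcs-arc ws xy)
  ... | inj₂ (inj₂ yx) = inj₂ (explodeAll-noArcs-arc ws yx)

  module _ (adj? : Decidable (Adj G)) (_≟_ : DecidableEquality V) where

    UAdj? : ∀ {A} → Decidable A → Decidable (UAdj G A)
    UAdj? A? x y = adj? x y ⊎-dec (A? x y ⊎-dec A? y x)

    explode? : ∀ {A} w → Decidable A → Decidable (explode G A w)
    explode? w A? x z = A? x z ⊎-dec ((x ≟ w) ×-dec (¬? (z ≟ w) ×-dec ¬? (UAdj? A? w z)))

    explode-universal : ∀ {A} → Decidable A → ∀ {w z} → z ≢ w → UAdj G (explode G A w) w z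
    explode-universal {A} A? {w} {z} z≢w with UAdj? A? w z
    ... | yes wz = explode-mono {A} wz
    ... | no ¬wz = inj₂ (inj₁ (inj₂ (refl , z≢w , ¬wz)))

    explodeAll-universal : ∀ {A} → Decidable A → ∀ {ws w z} → w ∈ ws → z ≢ w →
                           UAdj G (explodeAll G A ws) w z
    explodeAll-universal A? {_ ∷ ws} (here refl)  z≢w =
      explodeAll-mono ws (explode-universal A? z≢w)
    explodeAll-universal A? {v ∷ _}  (there w∈ws) z≢w =
      explodeAll-universal (explode? v A?) w∈ws z≢w

∈-─⁺ : {A : Set} {x y : A} {ys : List A} (x∈ys : x ∈ ys) → y ∈ ys → y ≢ x → y ∈ (ys ─ x∈ys)
∈-─⁺ (here refl) (here refl) y≢x = ⊥-elim (y≢x refl)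
∈-─⁺ (here refl) (there y∈)  y≢x = y∈
∈-─⁺ (there x∈)  (here refl) y≢x = here refl
∈-─⁺ (there x∈)  (there y∈)  y≢x = there (∈-─⁺ x∈ y∈ y≢x)

injectiveOn⇒length≤ : {A B : Set} (f : A → B) {xs : List A} {ys : List B} → Unique xs →
                      (∀ {x} → x ∈ xs → f x ∈ ys) →
                      (∀ {x y} → x ∈ xs → y ∈ xs → f x ≡ f y → x ≡ y) →
                      length xs ≤ length ys
injectiveOn⇒length≤ f {[]}     _             _    _   = z≤n
injectiveOn⇒length≤ f {x ∷ xs} {ys} (x∉xs ∷ xs!) into inj
  rewrite length-removeAt′ ys (Any.index (into (here refl))) =
  s≤s (injectiveOn⇒length≤ f xs! into′ (λ x∈ y∈ → inj (there x∈) (there y∈)))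
  where
    into′ : ∀ {y} → y ∈ xs → f y ∈ (ys ─ into (here refl))
    into′ y∈ = ∈-─⁺ (into (here refl)) (into (there y∈))
                 (λ fy≡fx → All.lookup x∉xs y∈ (≡.sym (inj (there y∈) (here refl) fy≡fx)))

first : ∀ {n} → Fin n → Fin n
first zero    = zero
first (suc _) = zero

first-unique : ∀ {n} (a b : Fin n) → first a ≡ first b
first-unique zero    zero    = refl
first-unique zero    (suc _) = refl
first-unique (suc _) zero    = refl
first-unique (suc _) (suc _) = refl

nonZero : (n : ℕ) → List (Fin n)
nonZero ℕ.zero = []
nonZero (suc k) = tabulate suc

∈-nonZero⇒≢first : ∀ {n} {j : Fin n} → j ∈ nonZero n → j ≢ first j
∈-nonZero⇒≢first {suc k} j∈ with ∈-tabulate⁻ j∈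
... | _ , refl = λ ()

∈-nonZero-or-first : ∀ {n} (j : Fin n) → j ∈ nonZero n ⊎ j ≡ first j
∈-nonZero-or-first zero    = inj₂ refl
∈-nonZero-or-first (suc j) = inj₁ (∈-tabulate⁺ j)

nonZero-unique : ∀ n → Unique (nonZero n)
nonZero-unique ℕ.zero  = []
nonZero-unique (suc k) = Unique.tabulate⁺ suc-injective

length-nonZero : ∀ k → length (nonZero (suc k)) ≡ k
length-nonZero k = length-tabulate suc

module _ {m} (n : ℕ) (ns : Vec ℕ m) where

  zeroPart : Fin n → MPVertex (n ∷ ns)
  zeroPart j = zero , j

  sucPart : MPVertex ns → MPVertex (n ∷ ns)
  sucPart (i , j) = suc i , j

  zeroPart-injective : ∀ {j j′} → zeroPart j ≡ zeroPart j′ → j ≡ j′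
  zeroPart-injective refl = refl

  sucPart-injective : ∀ {u v} → sucPart u ≡ sucPart v → u ≡ v
  sucPart-injective {_ , _} {_ , _} refl = refl

-- The representative of a part is its vertex of index zero; reading it off a vertex of the
-- part avoids having to know that the part is nonempty.
rep : ∀ {m} (ns : Vec ℕ m) → MPVertex ns → MPVertex ns
rep _ (i , j) = i , first j

rep-cong : ∀ {m} {ns : Vec ℕ m} {u v : MPVertex ns} → proj₁ u ≡ proj₁ v → rep ns u ≡ rep ns v
rep-cong {u = i , a} {v = .i , b} refl = cong (i ,_) (first-unique a b)

≡rep⇒≡rep-self : ∀ {m} {ns : Vec ℕ m} {u v : MPVertex ns} → u ≡ rep ns v → u ≡ rep ns u
≡rep⇒≡rep-self {ns = ns} u≡ = ≡.trans u≡ (rep-cong {ns = ns} (≡.sym (cong proj₁ u≡)))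

nonReps : ∀ {m} (ns : Vec ℕ m) → List (MPVertex ns)
nonReps []       = []
nonReps (n ∷ ns) = map (zeroPart n ns) (nonZero n) ++ map (sucPart n ns) (nonReps ns)

∈-nonReps⇒≢rep : ∀ {m} (ns : Vec ℕ m) {v} → v ∈ nonReps ns → v ≢ rep ns v
∈-nonReps⇒≢rep (n ∷ ns) v∈ with ∈-++⁻ (map (zeroPart n ns) (nonZero n)) v∈
... | inj₁ v∈₀ with ∈-map⁻ (zeroPart n ns) v∈₀
...   | j , j∈ , refl = λ e → ∈-nonZero⇒≢first j∈ (zeroPart-injective n ns e)
∈-nonReps⇒≢rep (n ∷ ns) v∈ | inj₂ v∈ₛ with ∈-map⁻ (sucPart n ns) v∈ₛ
...   | (i , j) , u∈ , refl = λ e → ∈-nonReps⇒≢rep ns u∈ (sucPart-injective n ns e)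

∈-nonReps-or-rep : ∀ {m} (ns : Vec ℕ m) (v : MPVertex ns) → v ∈ nonReps ns ⊎ v ≡ rep ns v
∈-nonReps-or-rep (n ∷ ns) (zero , j) with ∈-nonZero-or-first j
... | inj₁ j∈ = inj₁ (∈-++⁺ˡ (∈-map⁺ (zeroPart n ns) j∈))
... | inj₂ j≡ = inj₂ (cong (zeroPart n ns) j≡)
∈-nonReps-or-rep (n ∷ ns) (suc i , j) with ∈-nonReps-or-rep ns (i , j)
... | inj₁ v∈ = inj₁ (∈-++⁺ʳ (map (zeroPart n ns) (nonZero n)) (∈-map⁺ (sucPart n ns) v∈))
... | inj₂ v≡ = inj₂ (cong (sucPart n ns) v≡)

nonReps-unique : ∀ {m} (ns : Vec ℕ m) → Unique (nonReps ns)
nonReps-unique []       = []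
nonReps-unique (n ∷ ns) =
  Unique.++⁺ (Unique.map⁺ (zeroPart-injective n ns) (nonZero-unique n))
             (Unique.map⁺ (sucPart-injective n ns) (nonReps-unique ns))
             disjoint
  where
    disjoint : ∀ {v} → ¬ (v ∈ map (zeroPart n ns) (nonZero n) ×
                          v ∈ map (sucPart n ns) (nonReps ns))
    disjoint (v∈₀ , v∈ₛ) with ∈-map⁻ (zeroPart n ns) v∈₀ | ∈-map⁻ (sucPart n ns) v∈ₛ
    ... | _ , _ , refl | _ , _ , ()

length-nonReps : ∀ {m} (ns : Vec ℕ m) → (∀ i → 1 ≤ lookup ns i) →
                 length (nonReps ns) + m ≡ sum ns
length-nonReps []       _   = refl
length-nonReps {suc m} (n ∷ ns) pos with pos zero
... | s≤s {n = k} _ = begin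
  length (map (zeroPart n ns) (nonZero n) ++ map (sucPart n ns) (nonReps ns)) + suc m
    ≡⟨ cong (_+ suc m) (length-++ (map (zeroPart n ns) (nonZero n))) ⟩
  length (map (zeroPart n ns) (nonZero n)) + length (map (sucPart n ns) (nonReps ns)) + suc m
    ≡⟨ cong (_+ suc m) (≡.cong₂ _+_ (length-map (zeroPart n ns) (nonZero n))
                                      (length-map (sucPart n ns) (nonReps ns))) ⟩
  length (nonZero n) + length (nonReps ns) + suc m
    ≡⟨ +-assoc (length (nonZero n)) _ (suc m) ⟩
  length (nonZero n) + (length (nonReps ns) + suc m)
    ≡⟨ cong (length (nonZero n) +_) (+-suc (length (nonReps ns)) m) ⟩
  length (nonZero n) + suc (length (nonReps ns) + m)
    ≡⟨ +-suc (length (nonZero n)) _ ⟩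
  suc (length (nonZero n)) + (length (nonReps ns) + m)
    ≡⟨ ≡.cong₂ (λ a b → suc a + b) (length-nonZero k) (length-nonReps ns (λ i → pos (suc i))) ⟩
  n + sum ns ∎
  where open ≡.≡-Reasoning

module _ {m} (ns : Vec ℕ m) where

  private
    K = completeMultipartite ns
    open Explosion K

    _≟_ : DecidableEquality (MPVertex ns)
    _≟_ = ≡-dec Fin._≟_ Fin._≟_

    adj? : Decidable (Adj K)
    adj? u v = ¬? (proj₁ u Fin.≟ proj₁ v)

    noArcs? : Decidable (noArcs {MPVertex ns})
    noArcs? _ _ = no λ ()

  nonReps-complete : CompleteAfter K (nonReps ns)
  nonReps-complete u v u≢v with ∈-nonReps-or-rep ns u | ∈-nonReps-or-rep ns v
  ... | inj₁ u∈ | _       = explodeAll-universal adj? _≟_ noArcs? u∈ (λ v≡u → u≢v (≡.sym v≡u))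
  ... | inj₂ _  | inj₁ v∈ =
    UAdj-sym {A = explodeAll K noArcs (nonReps ns)} (explodeAll-universal adj? _≟_ noArcs? v∈ u≢v)
  ... | inj₂ u≡ | inj₂ v≡ = inj₁ λ e → u≢v (≡.trans u≡ (≡.trans (rep-cong {ns = ns} e) (≡.sym v≡)))

  module _ {ws : List (MPVertex ns)} (complete : CompleteAfter K ws) where

    private
      charge : MPVertex ns → MPVertex ns
      charge v with _∈?_ _≟_ v ws
      ... | yes _ = v
      ... | no  _ = rep ns v

      samePart-covered : ∀ {u v} → proj₁ u ≡ proj₁ v → u ≢ v → u ∈ ws ⊎ v ∈ ws
      samePart-covered e u≢v = complete⇒cover ws complete u≢v (λ ¬e → ¬e e)

      charge-∈ : ∀ {v} → v ∈ nonReps ns → charge v ∈ ws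
      charge-∈ {v} v∈ with _∈?_ _≟_ v ws
      ... | yes v∈ws = v∈ws
      ... | no  v∉ws with samePart-covered refl (λ e → ∈-nonReps⇒≢rep ns v∈ (≡.sym e))
      ...   | inj₁ rep∈ws = rep∈ws
      ...   | inj₂ v∈ws   = ⊥-elim (v∉ws v∈ws)

      charge-injective : ∀ {u v} → u ∈ nonReps ns → v ∈ nonReps ns → charge u ≡ charge v → u ≡ v
      charge-injective {u} {v} u∈ v∈ e with _∈?_ _≟_ u ws | _∈?_ _≟_ v ws
      ... | yes _    | yes _    = e
      ... | yes _    | no  _    = ⊥-elim (∈-nonReps⇒≢rep ns u∈ (≡rep⇒≡rep-self {ns = ns} e))
      ... | no  _    | yes _    = ⊥-elim (∈-nonReps⇒≢rep ns v∈ (≡rep⇒≡rep-self {ns = ns} (≡.sym e)))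
      ... | no  u∉ws | no  v∉ws with u ≟ v
      ...   | yes u≡v = u≡v
      ...   | no  u≢v with samePart-covered (cong proj₁ e) u≢v
      ...     | inj₁ u∈ws = ⊥-elim (u∉ws u∈ws)
      ...     | inj₂ v∈ws = ⊥-elim (v∉ws v∈ws)

    complete⇒length-nonReps≤ : length (nonReps ns) ≤ length ws
    complete⇒length-nonReps≤ =
      injectiveOn⇒length≤ charge (nonReps-unique ns) charge-∈ charge-injective

proposition2p8 : (ℓ : ℕ) → 1 ≤ ℓ → (ns : Vec ℕ ℓ) → (∀ i → 1 ≤ lookup ns i) →
    McPherson (completeMultipartite ns) (sum ns ∸ ℓ)
proposition2p8 ℓ _ ns pos =
  (nonReps ns , length≡ , nonReps-complete ns) ,
  λ ws complete → ≤-trans (≤-reflexive (≡.sym length≡)) (complete⇒length-nonReps≤ ns {ws} complete)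
  where
    length≡ : length (nonReps ns) ≡ sum ns ∸ ℓ
    length≡ = ≡.trans (≡.sym (m+n∸n≡m (length (nonReps ns)) ℓ))
                      (cong (_∸ ℓ) (length-nonReps ns pos))
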